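{- For every $k\ge3$ and every $n\in\mathbb{N}$, $h_k(n)\le G_{\phi_{k-2}(0)}(3n+2)$.
   Context: $h_1(n)=n^2+2$ and $h_{k+1}(n)=h_k^{(n)}(2)$ (the $n$-fold iterate of $h_k$ applied to $2$). Constructive ordinals: $\Omega$ is the set of infinitary terms generated by $0$, successor $\alpha+1$, and limits $\langle\alpha_i\rangle_{i\in\mathbb{N}}$. $o(0)=0$, $o(n+1)=o(n)+1$, $\omega=\langle o(i+1)\rangle_i$. Arithmetic: $\alpha+0=\alpha$, $\alpha+(\beta+1)=(\alpha+\beta)+1$, $\alpha+\langle\beta_i\rangle=\langle\alpha+\beta_i\rangle$; $\alpha\cdot0=0$, $\alpha\cdot(\beta+1)=\alpha\cdot\beta+\alpha$, $\alpha\cdot\langle\beta_i\rangle=\langle\alpha\cdot\beta_i\rangle$; $\alpha^0=o(1)$, $\alpha^{\beta+1}=\alpha^\beta\cdot\alpha$, $\alpha^{\langle\beta_i\rangle}=\langle\alpha^{\beta_i}\rangle$. Veblen functions: $\phi_0(\gamma)=\omega^\gamma$; $\phi_{k+1}(0)=\langle\phi_k^{(i)}(0)\rangle_i$; $\phi_{k+1}(\gamma+1)=\langle\phi_k^{(i)}(\phi_{k+1}(\gamma)+1)\rangle_i$; $\phi_{k+1}(\langle\gamma_i\rangle)=\langle\phi_{k+1}(\gamma_i)\rangle_i$. Slow-growing hierarchy: $G_0(n)=0$, $G_{\alpha+1}(n)=G_\alpha(n)+1$, $G_{\langle\alpha_i\rangle}(n)=G_{\alpha_n}(n)$. -}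

module Defs where

open import Data.Nat using (ℕ; zero; suc; _+_; _*_)

iter : {A : Set} → (A → A) → ℕ → A → A
iter f zero    x = x
iter f (suc n) x = f (iter f n x)

h₁ : ℕ → ℕ
h₁ n = n * n + 2

-- hh k = h_{k+1}
hh : ℕ → ℕ → ℕ
hh zero    = h₁
hh (suc k) = λ n → iter (hh k) n 2

-- h k = h_k for k ≥ 1 (h 0 is an unused filler, set to 0)
h : ℕ → ℕ → ℕ
h zero    _ = 0
h (suc k) = hh k

data Ω : Set where
  O0  : Ω
  _⁺  : Ω → Ω
  lim : (ℕ → Ω) → Ω

o : ℕ → Ω
o zero    = O0
o (suc n) = o n ⁺

ω : Ω
ω = lim (λ i → o (suc i))

_⊕_ : Ω → Ω → Ω
α ⊕ O0      = α
α ⊕ (β ⁺)   = (α ⊕ β) ⁺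
α ⊕ lim βs  = lim (λ i → α ⊕ βs i)

_⊗_ : Ω → Ω → Ω
α ⊗ O0     = O0
α ⊗ (β ⁺)  = (α ⊗ β) ⊕ α
α ⊗ lim βs = lim (λ i → α ⊗ βs i)

_^Ω_ : Ω → Ω → Ω
α ^Ω O0     = o 1
α ^Ω (β ⁺)  = (α ^Ω β) ⊗ α
α ^Ω lim βs = lim (λ i → α ^Ω βs i)

φ : ℕ → Ω → Ω
φ zero γ = ω ^Ω γ
φ (suc k) O0       = lim (λ i → iter (φ k) i O0)
φ (suc k) (γ ⁺)    = lim (λ i → iter (φ k) i (φ (suc k) γ ⁺))
φ (suc k) (lim γs) = lim (λ i → φ (suc k) (γs i))

G : Ω → ℕ → ℕ
G O0       n = 0
G (α ⁺)    n = suc (G α n)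
G (lim αs) n = G (αs n) n

-- Evaluating at a fixed argument m, G commutes with +, · and exponentiation, so it
-- turns φ k into a number-theoretic Veblen function φℕ m k in which ω becomes m + 1
-- and every fundamental sequence is read at its m-th term.  For m ≥ 2, induction on j
-- gives h_{j+2}(z) ≤ φℕ_j(φℕ_j(z)); hence n iterations of h_{j+2} from 2 stay below
-- 2n + 2 iterations of φℕ_j from 0, and these are bounded by φℕ_{j+1}(0) once
-- m ≥ 2n + 2.  The choice m = 3n + 2 is enough.
module Submission where

open import Defs
open import Data.Nat using (ℕ; zero; suc; _+_; _*_; _∸_; _^_; _≤_; _<_; z≤n; s≤s)
open import Data.Nat.Properties
open import Relation.Binary.Core using (_Preserves_⟶_)
open import Relation.Binary.PropositionalEquality using (_≡_; refl; sym; trans; cong; module ≡-Reasoning)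

n<m^n : ∀ {m} → 1 < m → ∀ n → n < m ^ n
n<m^n _ zero = s≤s z≤n
n<m^n {m@(suc (suc k))} 1<m@(s≤s (s≤s _)) (suc n) = begin
  2 + n                          ≡⟨ +-comm 1 (suc n) ⟩
  suc n + 1                      ≤⟨ +-mono-≤ (n<m^n 1<m n) (≤-trans (m^n>0 m n) (m≤m+n (m ^ n) (k * m ^ n))) ⟩
  m ^ n + (m ^ n + k * m ^ n)    ∎
  where open ≤-Reasoning

m*m+2≤m^3 : ∀ {m} → 2 ≤ m → m * m + 2 ≤ m ^ 3
m*m+2≤m^3 {m} 2≤m = begin
  m * m + 2              ≤⟨ +-monoʳ-≤ (m * m) (*-mono-≤ (<⇒≤ 2≤m) 2≤m) ⟩
  m * m + m * m          ≡⟨ cong (m * m +_) (sym (+-identityʳ (m * m))) ⟩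
  2 * (m * m)            ≤⟨ *-monoˡ-≤ (m * m) 2≤m ⟩
  m * (m * m)            ≡⟨ cong (λ x → m * (m * x)) (sym (*-identityʳ m)) ⟩
  m ^ 3                  ∎
  where open ≤-Reasoning

iter-h₁-≤-tower : ∀ {b} → 3 ≤ b → ∀ z → iter h₁ z 2 ≤ b ^ (b ^ z)
iter-h₁-≤-tower {b} 3≤b@(s≤s _) zero = ≤-trans (<⇒≤ 3≤b) (≤-reflexive (sym (*-identityʳ b)))
iter-h₁-≤-tower {b} 3≤b@(s≤s _) (suc z) = begin
  x * x + 2                ≤⟨ +-monoˡ-≤ 2 (*-mono-≤ x≤A x≤A) ⟩
  A * A + 2                ≤⟨ m*m+2≤m^3 (≤-trans (<⇒≤ 3≤b) b≤A) ⟩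
  A ^ 3                    ≤⟨ ^-monoʳ-≤ A {{m^n≢0 b (b ^ z)}} 3≤b ⟩
  A ^ b                    ≡⟨ ^-*-assoc b (b ^ z) b ⟩
  b ^ (b ^ z * b)          ≡⟨ cong (b ^_) (*-comm (b ^ z) b) ⟩
  b ^ (b * b ^ z)          ∎
  where
  open ≤-Reasoning
  x A : ℕ
  x = iter h₁ z 2
  A = b ^ (b ^ z)
  x≤A : x ≤ A
  x≤A = iter-h₁-≤-tower 3≤b z
  b≤A : b ≤ A
  b≤A = ≤-trans (≤-reflexive (sym (^-identityʳ b))) (^-monoʳ-≤ b (m^n>0 b z))

record Expansive (f : ℕ → ℕ) : Set where
  field
    monotone : f Preserves _≤_ ⟶ _≤_
    expands  : ∀ x → x < f x

module _ {f : ℕ → ℕ} (ef : Expansive f) where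
  open Expansive ef

  iter-≥-+ : ∀ a x → a + x ≤ iter f a x
  iter-≥-+ zero    x = ≤-refl
  iter-≥-+ (suc a) x = ≤-trans (s≤s (iter-≥-+ a x)) (expands (iter f a x))

  iter-monoˡ-≤ : ∀ x → (λ a → iter f a x) Preserves _≤_ ⟶ _≤_
  iter-monoˡ-≤ x {_} {b} z≤n = ≤-trans (m≤n+m x b) (iter-≥-+ b x)
  iter-monoˡ-≤ x (s≤s a≤b)   = monotone (iter-monoˡ-≤ x a≤b)

  iter-twice-dominates : ∀ {g} → (∀ x → g x ≤ f (f x)) → ∀ n → iter g n 2 ≤ iter f (2 + (n + n)) 0
  iter-twice-dominates g≤ff zero = iter-≥-+ 2 0
  iter-twice-dominates {g} g≤ff (suc n) = begin
    g (iter g n 2)                    ≤⟨ g≤ff (iter g n 2) ⟩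
    f (f (iter g n 2))                ≤⟨ monotone (monotone (iter-twice-dominates g≤ff n)) ⟩
    iter f (4 + (n + n)) 0            ≡⟨ cong (λ a → iter f (3 + a) 0) (sym (+-suc n n)) ⟩
    iter f (2 + (suc n + suc n)) 0    ∎
    where open ≤-Reasoning

monotone-by-step : ∀ {f} → (∀ x → f x ≤ f (suc x)) → f Preserves _≤_ ⟶ _≤_
monotone-by-step step {zero} {zero}  z≤n = ≤-refl
monotone-by-step step {zero} {suc y} z≤n = ≤-trans (monotone-by-step step {zero} {y} z≤n) (step y)
monotone-by-step {f} step (s≤s x≤y) = monotone-by-step {λ x → f (suc x)} (λ x → step (suc x)) x≤y

φℕ : ℕ → ℕ → ℕ → ℕ
φℕ m zero    y       = suc m ^ y
φℕ m (suc k) zero    = iter (φℕ m k) m 0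
φℕ m (suc k) (suc y) = iter (φℕ m k) m (suc (φℕ m (suc k) y))

module _ (m : ℕ) where

  G-⊕ : ∀ α β → G (α ⊕ β) m ≡ G α m + G β m
  G-⊕ α O0       = sym (+-identityʳ (G α m))
  G-⊕ α (β ⁺)    = trans (cong suc (G-⊕ α β)) (sym (+-suc (G α m) (G β m)))
  G-⊕ α (lim βs) = G-⊕ α (βs m)

  G-⊗ : ∀ α β → G (α ⊗ β) m ≡ G α m * G β m
  G-⊗ α O0       = sym (*-zeroʳ (G α m))
  G-⊗ α (β ⁺)    = begin
    G ((α ⊗ β) ⊕ α) m        ≡⟨ G-⊕ (α ⊗ β) α ⟩
    G (α ⊗ β) m + G α m      ≡⟨ cong (_+ G α m) (G-⊗ α β) ⟩
    G α m * G β m + G α m    ≡⟨ +-comm (G α m * G β m) (G α m) ⟩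
    G α m + G α m * G β m    ≡⟨ sym (*-suc (G α m) (G β m)) ⟩
    G α m * suc (G β m)      ∎
    where open ≡-Reasoning
  G-⊗ α (lim βs) = G-⊗ α (βs m)

  G-^ : ∀ α β → G (α ^Ω β) m ≡ G α m ^ G β m
  G-^ α O0       = refl
  G-^ α (β ⁺)    = trans (G-⊗ (α ^Ω β) α) (trans (cong (_* G α m) (G-^ α β)) (*-comm (G α m ^ G β m) (G α m)))
  G-^ α (lim βs) = G-^ α (βs m)

  G-o : ∀ n → G (o n) m ≡ n
  G-o zero    = refl
  G-o (suc n) = cong suc (G-o n)

  G-iter : ∀ {F : Ω → Ω} {f : ℕ → ℕ} → (∀ γ → G (F γ) m ≡ f (G γ m)) →
           ∀ i γ → G (iter F i γ) m ≡ iter f i (G γ m)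
  G-iter GF≡fG zero    γ = refl
  G-iter {F} {f} GF≡fG (suc i) γ = trans (GF≡fG (iter F i γ)) (cong f (G-iter GF≡fG i γ))

  G-φ : ∀ k γ → G (φ k γ) m ≡ φℕ m k (G γ m)
  G-φ zero    γ        = trans (G-^ ω γ) (cong (_^ G γ m) (G-o (suc m)))
  G-φ (suc k) O0       = G-iter (G-φ k) m O0
  G-φ (suc k) (γ ⁺)    = trans (G-iter (G-φ k) m (φ (suc k) γ ⁺))
                               (cong (λ y → iter (φℕ m k) m (suc y)) (G-φ (suc k) γ))
  G-φ (suc k) (lim γs) = G-φ (suc k) (γs m)

φℕ-expansive : ∀ {m} → 1 ≤ m → ∀ k → Expansive (φℕ m k)
φℕ-expansive {m} 1≤m zero = record
  { monotone = ^-monoʳ-≤ (suc m)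
  ; expands  = n<m^n (s≤s 1≤m)
  }
φℕ-expansive {m} 1≤m (suc k) = record
  { monotone = monotone-by-step step
  ; expands  = F-expands
  }
  where
  ef : Expansive (φℕ m k)
  ef = φℕ-expansive 1≤m k
  F : ℕ → ℕ
  F = φℕ m (suc k)
  iterates-≥ : ∀ x → suc x ≤ iter (φℕ m k) m (suc x)
  iterates-≥ x = ≤-trans (m≤n+m (suc x) m) (iter-≥-+ ef m (suc x))
  step : ∀ y → F y ≤ F (suc y)
  step y = <⇒≤ (iterates-≥ (F y))
  F-expands : ∀ y → y < F y
  F-expands zero    = ≤-trans (≤-trans 1≤m (m≤m+n m 0)) (iter-≥-+ ef m 0)
  F-expands (suc y) = ≤-trans (s≤s (F-expands y)) (iterates-≥ (F y))

iter-φℕ-≤-φℕ-suc : ∀ {m} → 2 ≤ m → ∀ k z → iter (φℕ m k) (2 + (z + z)) 0 ≤ φℕ m (suc k) z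
iter-φℕ-≤-φℕ-suc 2≤m k zero = iter-monoˡ-≤ (φℕ-expansive (<⇒≤ 2≤m) k) 0 2≤m
iter-φℕ-≤-φℕ-suc {m} 2≤m k (suc z) = begin
  iter F (2 + (suc z + suc z)) 0     ≡⟨ cong (λ a → iter F (3 + a) 0) (+-suc z z) ⟩
  F (F (iter F (2 + (z + z)) 0))     ≤⟨ monotone (monotone (≤-trans (iter-φℕ-≤-φℕ-suc 2≤m k z) (n≤1+n _))) ⟩
  F (F (suc (φℕ m (suc k) z)))       ≤⟨ iter-monoˡ-≤ ef (suc (φℕ m (suc k) z)) 2≤m ⟩
  φℕ m (suc k) (suc z)               ∎
  where
  open ≤-Reasoning
  F : ℕ → ℕ
  F = φℕ m k
  ef : Expansive F
  ef = φℕ-expansive (<⇒≤ 2≤m) k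
  open Expansive ef

hh-suc-≤-φℕ² : ∀ {m} → 2 ≤ m → ∀ j z → hh (suc j) z ≤ φℕ m j (φℕ m j z)
hh-suc-≤-φℕ² 2≤m zero z = iter-h₁-≤-tower (s≤s 2≤m) z
hh-suc-≤-φℕ² {m} 2≤m (suc j) z = begin
  iter (hh (suc j)) z 2                ≤⟨ iter-twice-dominates (φℕ-expansive 1≤m j) (hh-suc-≤-φℕ² 2≤m j) z ⟩
  iter (φℕ m j) (2 + (z + z)) 0        ≤⟨ iter-φℕ-≤-φℕ-suc 2≤m j z ⟩
  φℕ m (suc j) z                       ≤⟨ <⇒≤ (Expansive.expands (φℕ-expansive 1≤m (suc j)) _) ⟩
  φℕ m (suc j) (φℕ m (suc j) z)        ∎
  where
  open ≤-Reasoning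
  1≤m : 1 ≤ m
  1≤m = <⇒≤ 2≤m

hh-≤-φℕ-suc-zero : ∀ {m} j n → 2 + (n + n) ≤ m → hh (suc (suc j)) n ≤ φℕ m (suc j) 0
hh-≤-φℕ-suc-zero {m} j n 2n+2≤m = begin
  iter (hh (suc j)) n 2                ≤⟨ iter-twice-dominates ef (hh-suc-≤-φℕ² 2≤m j) n ⟩
  iter (φℕ m j) (2 + (n + n)) 0        ≤⟨ iter-monoˡ-≤ ef 0 2n+2≤m ⟩
  φℕ m (suc j) 0                       ∎
  where
  open ≤-Reasoning
  2≤m : 2 ≤ m
  2≤m = ≤-trans (m≤m+n 2 (n + n)) 2n+2≤m
  ef : Expansive (φℕ m j)
  ef = φℕ-expansive (<⇒≤ 2≤m) j

corollary8p8 : (k n : ℕ) → 3 ≤ k → h k n ≤ G (φ (k ∸ 2) O0) (3 * n + 2)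
corollary8p8 (suc (suc (suc j))) n (s≤s (s≤s (s≤s _))) = begin
  hh (suc (suc j)) n       ≤⟨ hh-≤-φℕ-suc-zero j n 2n+2≤3n+2 ⟩
  φℕ m (suc j) 0           ≡⟨ G-φ m (suc j) O0 ⟨
  G (φ (suc j) O0) m       ∎
  where
  open ≤-Reasoning
  m : ℕ
  m = 3 * n + 2
  2n+2≤3n+2 : 2 + (n + n) ≤ m
  2n+2≤3n+2 = begin
    2 + (n + n)            ≡⟨ +-comm 2 (n + n) ⟩
    n + n + 2              ≤⟨ +-monoˡ-≤ 2 (+-monoʳ-≤ n (m≤m+n n (n + 0))) ⟩
    3 * n + 2              ∎
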